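{- Let $q\ge 1$ and $n\ge 0$ be integers with $q>\lceil n/2\rceil$, and let $a_1,\dots,a_n\in\mathbb{Z}_q$ be reduced residues (i.e. $\gcd(a_i,q)=1$ for all $i$). Then the number of the $2^n$ choices $(\varepsilon_1,\dots,\varepsilon_n)\in\{0,1\}^n$ with $\sum_{i=1}^n\varepsilon_i a_i\equiv 0\pmod q$ is at most $\binom{n}{\lfloor n/2\rfloor}$. Moreover this bound is best possible: for all such $n,q$ there exist reduced residues $a_1,\dots,a_n$ attaining it.
   Context: $\mathbb{Z}_q$ denotes the integers modulo $q$. -}

module Defs where

open import Data.Nat using (ℕ; zero; suc; _+_; _%_; NonZero)
open import Data.Nat.Properties using (_≟_)
open import Data.Bool using (Bool; true; false)
open import Data.Fin using (Fin; toℕ)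
open import Data.Vec using (Vec; []; _∷_)
open import Data.List using (List; []; _∷_; _++_; map; length; filter)
open import Relation.Binary.PropositionalEquality using (_≡_)
open import Relation.Nullary using (Dec)

allChoices : (n : ℕ) → List (Vec Bool n)
allChoices zero = [] ∷ []
allChoices (suc n) = map (false ∷_) (allChoices n) ++ map (true ∷_) (allChoices n)

-- Σ εᵢ aᵢ, computed in ℕ from the canonical representatives of aᵢ ∈ ℤ_q = Fin q.
subsetSum : ∀ {q n} → Vec Bool n → Vec (Fin q) n → ℕ
subsetSum [] [] = 0
subsetSum (false ∷ ε) (a ∷ as) = subsetSum ε as
subsetSum (true ∷ ε) (a ∷ as) = toℕ a + subsetSum ε as

ZeroSum : ∀ (q : ℕ) .{{_ : NonZero q}} {n} → Vec (Fin q) n → Vec Bool n → Set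
ZeroSum q a ε = subsetSum ε a % q ≡ 0

zeroSum? : ∀ (q : ℕ) .{{_ : NonZero q}} {n} (a : Vec (Fin q) n) (ε : Vec Bool n) → Dec (ZeroSum q a ε)
zeroSum? q a ε = subsetSum ε a % q ≟ 0

zeroSumCount : ∀ (q : ℕ) .{{_ : NonZero q}} {n} → Vec (Fin q) n → ℕ
zeroSumCount q {n} a = length (filter (zeroSum? q a) (allChoices n))

-- Let hits S a count the choices ε with Σ εᵢ aᵢ ∈ S (mod q). Splitting on ε₁ gives
-- hits S (a₁ ∷ a) = hits S a + hits (S − a₁) a. The sets S and S − a₁ have the same size k, and since a₁
-- is a unit they differ unless S is all of ℤ_q; so they can be rebalanced into sets of sizes k + 1
-- and k − 1 covering every residue equally often. By induction on n, |S| = k then forces hits S a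
-- to be at most the sum of the k largest binomial coefficients of row n, as long as n + k < 2q;
-- for S = {0} this is n C ⌊ n /2⌋. The bound is attained by a = (1, −1, 1, −1, …): every choice of
-- equally many +1s and −1s is a zero sum, and there are n C ⌊ n /2⌋ of them.
module Submission where

open import Defs
open import Data.Nat using (ℕ; suc; _≤_; _<_; ⌈_/2⌉; ⌊_/2⌋)
open import Data.Nat.Combinatorics using (_C_)
open import Data.Nat.Coprimality using (Coprime)
open import Data.Fin using (Fin; toℕ)
open import Data.Vec using (Vec)
open import Data.Vec.Relation.Unary.All using (All)
open import Data.Product using (_×_; Σ)
open import Relation.Binary.PropositionalEquality using (_≡_)

open import Data.Bool using (Bool; true; false; T; _∨_; _∧_)
open import Data.Empty using (⊥-elim)
import Data.Fin as Fin
open import Data.Fin.Properties using (toℕ-fromℕ)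
open import Data.List using (List; []; _∷_; _++_; map; length; filter)
open import Data.List.Properties using (length-++; length-map)
open import Data.Nat
open import Data.Nat.Combinatorics using (nCk+nC[k+1]≡[n+1]C[k+1]; k>n⇒nCk≡0)
open import Data.Nat.Coprimality using (coprime-Bézout; 1-coprimeTo; coprime-+) renaming (sym to Coprime-sym)
open import Data.Nat.DivMod
open import Data.Nat.GCD using (module Bézout)
open import Data.Nat.Properties
open import Data.Nat.Tactic.RingSolver using (solve-∀)
open import Data.Product using (_,_; proj₁; proj₂)
open import Data.Unit using (tt)
import Data.Vec as Vec
open import Data.Vec using ([]; _∷_)
open import Data.Vec.Relation.Unary.All using ([]; _∷_; universal)
open import Data.Vec.Relation.Unary.All.Properties using (map⁺)
open import Function using (_∘_)
open import Level using (0ℓ)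
open import Relation.Binary.PropositionalEquality
open import Relation.Nullary using (¬_; yes; no; isYes)
open import Relation.Nullary.Decidable using (fromWitness)
open import Relation.Unary using (Pred; Decidable)

open import Algebra.Properties.CommutativeSemigroup +-commutativeSemigroup using (interchange)

private variable
  A B : Set
  n : ℕ

∨-introʳ : ∀ {a b} → T b → T (a ∨ b)
∨-introʳ {true}  _ = tt
∨-introʳ {false} t = t

∧⇒∨ : ∀ {a b} → T (a ∧ b) → T (a ∨ b)
∧⇒∨ {true} _ = tt

∧-elimˡ : ∀ {a b} → T (a ∧ b) → T a
∧-elimˡ {true} _ = tt

χ : Bool → ℕ
χ false = 0
χ true  = 1

χ≤1 : ∀ b → χ b ≤ 1
χ≤1 false = z≤n
χ≤1 true  = ≤-refl

χ-T : ∀ {b} → T b → χ b ≡ 1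
χ-T {true} _ = refl

χ-mono : ∀ {a b} → (T a → T b) → χ a ≤ χ b
χ-mono {false}         _   = z≤n
χ-mono {true} {true}   _   = ≤-refl
χ-mono {true} {false}  a⇒b = ⊥-elim (a⇒b tt)

count : (A → Bool) → List A → ℕ
count P []       = 0
count P (x ∷ xs) = χ (P x) + count P xs

count-++ : ∀ (P : A → Bool) xs ys → count P (xs ++ ys) ≡ count P xs + count P ys
count-++ P []       ys = refl
count-++ P (x ∷ xs) ys = trans (cong (χ (P x) +_) (count-++ P xs ys)) (sym (+-assoc (χ (P x)) _ _))

count-map : ∀ (P : B → Bool) (f : A → B) xs → count P (map f xs) ≡ count (P ∘ f) xs
count-map P f []       = refl
count-map P f (x ∷ xs) = cong (χ (P (f x)) +_) (count-map P f xs)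

count-cong : ∀ {P Q : A → Bool} → (∀ x → P x ≡ Q x) → ∀ xs → count P xs ≡ count Q xs
count-cong P≗Q []       = refl
count-cong P≗Q (x ∷ xs) = cong₂ _+_ (cong χ (P≗Q x)) (count-cong P≗Q xs)

count-exchange : ∀ {P Q P′ Q′ : A → Bool} →
  (∀ x → χ (P x) + χ (Q x) ≡ χ (P′ x) + χ (Q′ x)) →
  ∀ xs → count P xs + count Q xs ≡ count P′ xs + count Q′ xs
count-exchange e []                             = refl
count-exchange {P = P} {Q} {P′} {Q′} e (x ∷ xs) = begin
  (χ (P x) + count P xs) + (χ (Q x) + count Q xs)       ≡⟨ interchange (χ (P x)) _ _ _ ⟩
  (χ (P x) + χ (Q x)) + (count P xs + count Q xs)       ≡⟨ cong₂ _+_ (e x) (count-exchange e xs) ⟩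
  (χ (P′ x) + χ (Q′ x)) + (count P′ xs + count Q′ xs)   ≡⟨ interchange (χ (P′ x)) _ _ _ ⟩
  (χ (P′ x) + count P′ xs) + (χ (Q′ x) + count Q′ xs)   ∎
  where open ≡-Reasoning

count≤length : ∀ (P : A → Bool) xs → count P xs ≤ length xs
count≤length P []       = z≤n
count≤length P (x ∷ xs) = +-mono-≤ (χ≤1 (P x)) (count≤length P xs)

count-mono : ∀ {P Q : A → Bool} → (∀ x → T (P x) → T (Q x)) → ∀ xs → count P xs ≤ count Q xs
count-mono P⊆Q []       = z≤n
count-mono P⊆Q (x ∷ xs) = +-mono-≤ (χ-mono (P⊆Q x)) (count-mono P⊆Q xs)

count-none : ∀ {P : A → Bool} → (∀ x → ¬ T (P x)) → ∀ xs → count P xs ≡ 0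
count-none none []       = refl
count-none {P = P} none (x ∷ xs) with P x | none x
... | false | _  = count-none none xs
... | true  | ¬t = ⊥-elim (¬t tt)

length-filter≡count : ∀ {P : Pred A 0ℓ} (P? : Decidable P) xs → length (filter P? xs) ≡ count (isYes ∘ P?) xs
length-filter≡count P? []       = refl
length-filter≡count P? (x ∷ xs) with P? x
... | yes _ = cong suc (length-filter≡count P? xs)
... | no  _ = length-filter≡count P? xs

-- Subsets of {0, …, N − 1}

card : ℕ → (ℕ → Bool) → ℕ
card zero    S = 0
card (suc N) S = χ (S 0) + card N (S ∘ suc)

_∪_ _∩_ : (ℕ → Bool) → (ℕ → Bool) → ℕ → Bool
(S ∪ S′) r = S r ∨ S′ r
(S ∩ S′) r = S r ∧ S′ r

card-cong : ∀ N {S S′} → (∀ r → r < N → S r ≡ S′ r) → card N S ≡ card N S′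
card-cong zero    S≗S′ = refl
card-cong (suc N) S≗S′ = cong₂ _+_ (cong χ (S≗S′ 0 z<s)) (card-cong N (λ r r<N → S≗S′ (suc r) (s<s r<N)))

card-mono : ∀ N {S S′} → (∀ r → r < N → T (S r) → T (S′ r)) → card N S ≤ card N S′
card-mono zero    S⊆S′ = z≤n
card-mono (suc N) S⊆S′ = +-mono-≤ (χ-mono (S⊆S′ 0 z<s)) (card-mono N (λ r r<N → S⊆S′ (suc r) (s<s r<N)))

card-∷ʳ : ∀ N S → card (suc N) S ≡ card N S + χ (S N)
card-∷ʳ zero    S = +-comm (χ (S 0)) 0
card-∷ʳ (suc N) S = trans (cong (χ (S 0) +_) (card-∷ʳ N (S ∘ suc))) (sym (+-assoc (χ (S 0)) _ _))

card-full : ∀ N S → (∀ r → r < N → T (S r)) → card N S ≡ N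
card-full zero    S full = refl
card-full (suc N) S full = cong₂ _+_ (χ-T (full 0 z<s)) (card-full N (S ∘ suc) (λ r r<N → full (suc r) (s<s r<N)))

card-none : ∀ N → card N (λ _ → false) ≡ 0
card-none zero    = refl
card-none (suc N) = card-none N

card≡0⇒none : ∀ N S → card N S ≡ 0 → ∀ r → r < N → ¬ T (S r)
card≡0⇒none (suc N) S c≡0 zero    _         Sr = 0≢1+n (trans (sym (m+n≡0⇒m≡0 (χ (S 0)) c≡0)) (χ-T Sr))
card≡0⇒none (suc N) S c≡0 (suc r) (s<s r<N)    = card≡0⇒none N (S ∘ suc) (m+n≡0⇒n≡0 (χ (S 0)) c≡0) r r<N

card>0⇒witness : ∀ N S → 0 < card N S → Σ ℕ λ r → r < N × T (S r)
card>0⇒witness (suc N) S c>0 with S 0 in S0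
... | true  = 0 , z<s , subst T (sym S0) tt
... | false with card>0⇒witness N (S ∘ suc) c>0
...   | r , r<N , Sr = suc r , s<s r<N , Sr

card-∪≤⇒⊆ : ∀ N S S′ → card N (S ∪ S′) ≤ card N S′ → ∀ r → r < N → T (S r) → T (S′ r)
card-∪≤⇒⊆ (suc N) S S′ ∪≤ zero _ Sr with S 0 | S′ 0
... | _     | true  = tt
... | false | false = Sr
... | true  | false = ⊥-elim (<⇒≱ ∪≤ (card-mono N (λ _ _ → ∨-introʳ)))
card-∪≤⇒⊆ (suc N) S S′ ∪≤ (suc r) (s<s r<N) =
  card-∪≤⇒⊆ N (S ∘ suc) (S′ ∘ suc) tail≤ r r<N
  where
  tail≤ : card N ((S ∪ S′) ∘ suc) ≤ card N (S′ ∘ suc)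
  tail≤ = +-cancelˡ-≤ (χ (S′ 0)) _ _
    (≤-trans (+-monoˡ-≤ _ (χ-mono (∨-introʳ {S 0}))) ∪≤)

SameCover : ℕ → (S S′ U V : ℕ → Bool) → Set
SameCover N S S′ U V = ∀ r → r < N → χ (S r) + χ (S′ r) ≡ χ (U r) + χ (V r)

card-sameCover : ∀ N {S S′ U V} → SameCover N S S′ U V → card N S + card N S′ ≡ card N U + card N V
card-sameCover zero    cover = refl
card-sameCover (suc N) {S} {S′} {U} {V} cover = begin
  (χ (S 0) + card N (S ∘ suc)) + (χ (S′ 0) + card N (S′ ∘ suc)) ≡⟨ interchange (χ (S 0)) _ _ _ ⟩
  (χ (S 0) + χ (S′ 0)) + (card N (S ∘ suc) + card N (S′ ∘ suc)) ≡⟨ cong₂ _+_ (cover 0 z<s) (card-sameCover N (λ r r<N → cover (suc r) (s<s r<N))) ⟩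
  (χ (U 0) + χ (V 0)) + (card N (U ∘ suc) + card N (V ∘ suc))   ≡⟨ interchange (χ (U 0)) _ _ _ ⟩
  (χ (U 0) + card N (U ∘ suc)) + (χ (V 0) + card N (V ∘ suc))   ∎
  where open ≡-Reasoning

Rebalancing : ℕ → (S S′ : ℕ → Bool) → ℕ → Set
Rebalancing N S S′ m = Σ (ℕ → Bool) λ U → Σ (ℕ → Bool) λ V → card N U ≡ m × SameCover N S S′ U V

_◂_ : Bool → (ℕ → Bool) → ℕ → Bool
(b ◂ S) zero    = b
(b ◂ S) (suc r) = S r

rebalancing-◂ : ∀ {N S S′ m} u v → χ (S 0) + χ (S′ 0) ≡ χ u + χ v →
  Rebalancing N (S ∘ suc) (S′ ∘ suc) m → Rebalancing (suc N) S S′ (χ u + m)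
rebalancing-◂ u v head (U , V , cU , cover) =
  u ◂ U , v ◂ V , cong (χ u +_) cU , λ { zero _ → head ; (suc r) (s<s r<N) → cover r r<N }

χ-cong₂ : ∀ {a b c d} → a ≡ c → b ≡ d → χ a + χ b ≡ χ c + χ d
χ-cong₂ = cong₂ (λ a b → χ a + χ b)

-- A point covered once goes to U only when the rest of S ∪ S′ is too small for U to reach size m.
rebalance-split : ∀ {N S S′} → χ (S 0) + χ (S′ 0) ≡ 1 →
  (∀ m → card N ((S ∩ S′) ∘ suc) ≤ m → m ≤ card N ((S ∪ S′) ∘ suc) → Rebalancing N (S ∘ suc) (S′ ∘ suc) m) →
  ∀ m → card N ((S ∩ S′) ∘ suc) ≤ m → m ≤ suc (card N ((S ∪ S′) ∘ suc)) → Rebalancing (suc N) S S′ m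
rebalance-split {N} {S} {S′} head rebalance-tail m lo hi with m ≤? card N ((S ∪ S′) ∘ suc)
... | yes m≤ = rebalancing-◂ {S = S} {S′} false true head (rebalance-tail m lo m≤)
rebalance-split head rebalance-tail zero lo hi | no m≰ = ⊥-elim (m≰ z≤n)
rebalance-split {N} {S} {S′} head rebalance-tail (suc m) lo (s≤s hi) | no m≰ =
  rebalancing-◂ {S = S} {S′} true false head (rebalance-tail m (≤-trans (card-mono N (λ r _ → ∧⇒∨ {S (suc r)})) (s≤s⁻¹ (≰⇒> m≰))) hi)

rebalance : ∀ N S S′ m → card N (S ∩ S′) ≤ m → m ≤ card N (S ∪ S′) → Rebalancing N S S′ m
rebalance zero S S′ zero    _ _  = S , S′ , refl , λ _ ()
rebalance zero S S′ (suc m) _ ()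
rebalance (suc N) S S′ m lo hi with S 0 in S0 | S′ 0 in S′0
rebalance (suc N) S S′ zero () hi | true | true
rebalance (suc N) S S′ (suc m) (s≤s lo) (s≤s hi) | true | true =
  rebalancing-◂ {S = S} {S′} true true (χ-cong₂ S0 S′0) (rebalance N (S ∘ suc) (S′ ∘ suc) m lo hi)
rebalance (suc N) S S′ m lo hi | false | false =
  rebalancing-◂ {S = S} {S′} false false (χ-cong₂ S0 S′0) (rebalance N (S ∘ suc) (S′ ∘ suc) m lo hi)
rebalance (suc N) S S′ m lo hi | true | false =
  rebalance-split {S = S} {S′} (χ-cong₂ S0 S′0) (rebalance N (S ∘ suc) (S′ ∘ suc)) m lo hi
rebalance (suc N) S S′ m lo hi | false | true =
  rebalance-split {S = S} {S′} (χ-cong₂ S0 S′0) (rebalance N (S ∘ suc) (S′ ∘ suc)) m lo hi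

[m+n%d]%d≡[m+n]%d : ∀ m n d .{{_ : NonZero d}} → (m + n % d) % d ≡ (m + n) % d
[m+n%d]%d≡[m+n]%d m n d = begin
  (m + n % d) % d           ≡⟨ %-distribˡ-+ m (n % d) d ⟩
  (m % d + n % d % d) % d   ≡⟨ cong (λ z → (m % d + z) % d) (m%n%n≡m%n n d) ⟩
  (m % d + n % d) % d       ≡⟨ %-distribˡ-+ m n d ⟨
  (m + n) % d               ∎
  where open ≡-Reasoning

coprime⇒inverse : ∀ {x d} .{{_ : NonZero d}} → Coprime x d → Σ ℕ λ y → (y * x) % d ≡ 1 % d
coprime⇒inverse {x} {d} c with coprime-Bézout c
... | Bézout.+- u v eq = u , trans (cong (_% d) (sym eq)) ([m+kn]%n≡m%n 1 v d)
... | Bézout.-+ u v eq = u * pred d , (begin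
  -- 1 + u x ≡ v d makes −u ≡ u (d − 1) an inverse of x.
  (u * pred d * x) % d                 ≡⟨ [m+kn]%n≡m%n _ v d ⟨
  (u * pred d * x + v * d) % d         ≡⟨ cong (λ z → (u * pred d * x + z) % d) eq ⟨
  (u * pred d * x + (1 + u * x)) % d   ≡⟨ cong (_% d) (regroup u (pred d) x) ⟩
  (1 + (u * x) * (1 + pred d)) % d     ≡⟨ cong (λ z → (1 + (u * x) * z) % d) (suc-pred d) ⟩
  (1 + (u * x) * d) % d                ≡⟨ [m+kn]%n≡m%n 1 (u * x) d ⟩
  1 % d                                ∎)
  where
  open ≡-Reasoning
  regroup : ∀ u e x → u * e * x + (1 + u * x) ≡ 1 + (u * x) * (1 + e)
  regroup = solve-∀

-- Sums of binomial coefficients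

-- topBinomials n k is the sum of the k largest of the numbers n C i (so 2 ^ n once k > n).
topBinomials : ℕ → ℕ → ℕ
topBinomials zero    zero    = 0
topBinomials zero    (suc k) = 1
topBinomials (suc n) zero    = 0
topBinomials (suc n) (suc k) = topBinomials n (suc (suc k)) + topBinomials n k

2^n+2^n≡2^[1+n] : ∀ n → 2 ^ n + 2 ^ n ≡ 2 ^ suc n
2^n+2^n≡2^[1+n] n = cong (2 ^ n +_) (sym (+-identityʳ (2 ^ n)))

topBinomials-saturated : ∀ {n k} → n < k → topBinomials n k ≡ 2 ^ n
topBinomials-saturated {zero}  {suc k} _         = refl
topBinomials-saturated {suc n} {suc k} (s<s n<k) =
  trans (cong₂ _+_ (topBinomials-saturated (m<n⇒m<1+n (m<n⇒m<1+n n<k))) (topBinomials-saturated n<k))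
        (2^n+2^n≡2^[1+n] n)

binomialWindow : ℕ → ℕ → ℕ → ℕ
binomialWindow n b zero    = 0
binomialWindow n b (suc k) = n C b + binomialWindow n (suc b) k

binomialWindow-pascal : ∀ n b k →
  binomialWindow (suc n) (suc b) k ≡ binomialWindow n b k + binomialWindow n (suc b) k
binomialWindow-pascal n b zero    = refl
binomialWindow-pascal n b (suc k) = begin
  suc n C suc b + binomialWindow (suc n) (suc (suc b)) k
    ≡⟨ cong₂ _+_ (nCk+nC[k+1]≡[n+1]C[k+1] n b) (sym (binomialWindow-pascal n (suc b) k)) ⟨
  (n C b + n C suc b) + (binomialWindow n (suc b) k + binomialWindow n (suc (suc b)) k)
    ≡⟨ interchange (n C b) _ _ _ ⟩
  binomialWindow n b (suc k) + binomialWindow n (suc b) (suc k)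
    ∎
  where open ≡-Reasoning

binomialWindow-beyond : ∀ {n b} k → n < b → binomialWindow n b k ≡ 0
binomialWindow-beyond zero    n<b = refl
binomialWindow-beyond (suc k) n<b =
  cong₂ _+_ (k>n⇒nCk≡0 n<b) (binomialWindow-beyond k (m<n⇒m<1+n n<b))

binomialWindow-row : ∀ {n k} → n < k → binomialWindow n 0 k ≡ 2 ^ n
binomialWindow-row {zero}  {suc k} _ = cong suc (binomialWindow-beyond k z<s)
binomialWindow-row {suc n} {suc k} (s<s n<k) = begin
  1 + binomialWindow (suc n) 1 k                        ≡⟨ cong suc (binomialWindow-pascal n 0 k) ⟩
  1 + (binomialWindow n 0 k + binomialWindow n 1 k)     ≡⟨ cong suc (+-comm (binomialWindow n 0 k) _) ⟩
  binomialWindow n 0 (suc k) + binomialWindow n 0 k     ≡⟨ cong₂ _+_ (binomialWindow-row (m<n⇒m<1+n n<k)) (binomialWindow-row n<k) ⟩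
  2 ^ n + 2 ^ n                                         ≡⟨ 2^n+2^n≡2^[1+n] n ⟩
  2 ^ suc n                                             ∎
  where open ≡-Reasoning

-- The k largest coefficients of row n are its k central ones.
topBinomials≡binomialWindow : ∀ n k d → k + d ≡ suc n → topBinomials n k ≡ binomialWindow n ⌊ d /2⌋ k
topBinomials≡binomialWindow zero    zero _ _ = refl
topBinomials≡binomialWindow (suc n) zero _ _ = refl
topBinomials≡binomialWindow n (suc k) zero k+0≡n
  with refl ← suc-injective (trans (sym (+-identityʳ (suc k))) k+0≡n) =
  trans (topBinomials-saturated (n<1+n k)) (sym (binomialWindow-row (n<1+n k)))
topBinomials≡binomialWindow zero (suc k) (suc d) k+d≡0 = ⊥-elim (0≢1+n (sym (suc-injective (trans (sym (+-suc (suc k) d)) k+d≡0))))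
topBinomials≡binomialWindow (suc n) (suc k) (suc zero) k+1≡n
  with refl ← suc-injective (trans (sym (+-comm (suc k) 1)) k+1≡n) = begin
  topBinomials k (suc (suc k)) + topBinomials k k
    ≡⟨ cong₂ _+_ (topBinomials-saturated (m<n⇒m<1+n (n<1+n k))) (topBinomials≡binomialWindow k k 1 (+-comm k 1)) ⟩
  2 ^ k + binomialWindow k 0 k
    ≡⟨ cong (_+ binomialWindow k 0 k) (binomialWindow-row (n<1+n k)) ⟨
  (1 + binomialWindow k 1 k) + binomialWindow k 0 k
    ≡⟨ cong suc (+-comm (binomialWindow k 1 k) _) ⟩
  1 + (binomialWindow k 0 k + binomialWindow k 1 k)
    ≡⟨ cong suc (binomialWindow-pascal k 0 k) ⟨
  binomialWindow (suc k) 0 (suc k)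
    ∎
  where open ≡-Reasoning
topBinomials≡binomialWindow (suc n) (suc k) (suc (suc d)) k+d≡n = begin
  topBinomials n (suc (suc k)) + topBinomials n k
    ≡⟨ cong₂ _+_ (topBinomials≡binomialWindow n (suc (suc k)) d e₁) (topBinomials≡binomialWindow n k (suc (suc d)) e₂) ⟩
  (n C b + binomialWindow n (suc b) (suc k)) + binomialWindow n (suc b) k
    ≡⟨ +-assoc (n C b) _ _ ⟩
  n C b + (binomialWindow n (suc b) (suc k) + binomialWindow n (suc b) k)
    ≡⟨ cong (n C b +_) (+-comm (binomialWindow n (suc b) (suc k)) _) ⟩
  n C b + (binomialWindow n (suc b) k + binomialWindow n (suc b) (suc k))
    ≡⟨ +-assoc (n C b) _ _ ⟨
  binomialWindow n b (suc k) + binomialWindow n (suc b) (suc k)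
    ≡⟨ binomialWindow-pascal n b (suc k) ⟨
  binomialWindow (suc n) (suc b) (suc k)
    ∎
  where
  open ≡-Reasoning
  b = ⌊ d /2⌋
  e₂ : k + suc (suc d) ≡ suc n
  e₂ = suc-injective k+d≡n
  e₁ : suc (suc k) + d ≡ suc n
  e₁ = trans (cong suc (sym (+-suc k d))) (trans (sym (+-suc k (suc d))) e₂)

topBinomials-1 : ∀ n → topBinomials n 1 ≡ n C ⌊ n /2⌋
topBinomials-1 n = trans (topBinomials≡binomialWindow n 1 n refl) (+-identityʳ _)

length-allChoices : ∀ n → length (allChoices n) ≡ 2 ^ n
length-allChoices zero    = refl
length-allChoices (suc n) = begin
  length (map (false ∷_) (allChoices n) ++ map (true ∷_) (allChoices n))
    ≡⟨ length-++ (map (false ∷_) (allChoices n)) ⟩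
  length (map (false ∷_) (allChoices n)) + length (map (true ∷_) (allChoices n))
    ≡⟨ cong₂ _+_ (length-map (false ∷_) (allChoices n)) (length-map (true ∷_) (allChoices n)) ⟩
  length (allChoices n) + length (allChoices n)
    ≡⟨ cong₂ _+_ (length-allChoices n) (length-allChoices n) ⟩
  2 ^ n + 2 ^ n
    ≡⟨ 2^n+2^n≡2^[1+n] n ⟩
  2 ^ suc n
    ∎
  where open ≡-Reasoning

count-allChoices : ∀ (P : Vec Bool (suc n) → Bool) →
  count P (allChoices (suc n)) ≡ count (P ∘ (false ∷_)) (allChoices n) + count (P ∘ (true ∷_)) (allChoices n)
count-allChoices {n} P = trans (count-++ P (map (false ∷_) (allChoices n)) _)
                               (cong₂ _+_ (count-map P _ (allChoices n)) (count-map P _ (allChoices n)))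

m+n<2n⇒m<n : ∀ m n → m + n < 2 * n → m < n
m+n<2n⇒m<n m n lt = +-cancelʳ-< n m n (subst (m + n <_) (cong (n +_) (+-identityʳ n)) lt)

⌈n/2⌉<m⇒n+1<2m : ∀ n m → ⌈ n /2⌉ < m → n + 1 < 2 * m
⌈n/2⌉<m⇒n+1<2m n m h = begin-strict
  n + 1                              ≡⟨ cong (_+ 1) (⌊n/2⌋+⌈n/2⌉≡n n) ⟨
  ⌊ n /2⌋ + ⌈ n /2⌉ + 1               ≤⟨ +-monoˡ-≤ 1 (+-monoˡ-≤ ⌈ n /2⌉ (⌊n/2⌋≤⌈n/2⌉ n)) ⟩
  ⌈ n /2⌉ + ⌈ n /2⌉ + 1               ≡⟨ +-comm (⌈ n /2⌉ + ⌈ n /2⌉) 1 ⟩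
  suc (⌈ n /2⌉ + ⌈ n /2⌉)             <⟨ n<1+n _ ⟩
  suc (suc (⌈ n /2⌉ + ⌈ n /2⌉))       ≡⟨ cong suc (+-suc ⌈ n /2⌉ ⌈ n /2⌉) ⟨
  suc ⌈ n /2⌉ + suc ⌈ n /2⌉           ≤⟨ +-mono-≤ h h ⟩
  m + m                              ≡⟨ cong (m +_) (+-identityʳ m) ⟨
  2 * m                              ∎
  where open ≤-Reasoning

-- Subset sums modulo q

module Residues (k : ℕ) where

  q : ℕ
  q = suc k

  shift : ℕ → (ℕ → Bool) → ℕ → Bool
  shift x S r = S ((x + r) % q)

  card-shift-1 : ∀ S → card q (shift 1 S) ≡ card q S
  card-shift-1 S = begin
    card q (shift 1 S)                         ≡⟨ card-∷ʳ k (shift 1 S) ⟩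
    card k (shift 1 S) + χ (S (q % q))         ≡⟨ cong₂ _+_ (card-cong k (λ r r<k → cong S (m<n⇒m%n≡m (s<s r<k)))) (cong (χ ∘ S) (n%n≡0 q)) ⟩
    card k (S ∘ suc) + χ (S 0)                 ≡⟨ +-comm (card k (S ∘ suc)) _ ⟩
    card q S                                   ∎
    where open ≡-Reasoning

  card-shift : ∀ x S → card q (shift x S) ≡ card q S
  card-shift zero    S = card-cong q (λ r r<q → cong S (m<n⇒m%n≡m r<q))
  card-shift (suc x) S = begin
    card q (shift (suc x) S)         ≡⟨ card-cong q (λ r _ → cong S ([m+n%d]%d≡[m+n]%d 1 (x + r) q)) ⟨
    card q (shift x (shift 1 S))     ≡⟨ card-shift x (shift 1 S) ⟩
    card q (shift 1 S)               ≡⟨ card-shift-1 S ⟩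
    card q S                         ∎
    where open ≡-Reasoning

  Closed : ℕ → (ℕ → Bool) → Set
  Closed x S = ∀ r → T (S (r % q)) → T (S ((x + r) % q))

  closed-* : ∀ {x S} → Closed x S → ∀ j → Closed (j * x) S
  closed-* closed zero    r Sr = Sr
  closed-* {x} {S} closed (suc j) r Sr =
    subst (T ∘ S ∘ (_% q)) (sym (+-assoc x (j * x) r)) (closed (j * x + r) (closed-* {x} {S} closed j r Sr))

  closed-% : ∀ {x y S} → x % q ≡ y % q → Closed x S → Closed y S
  closed-% {x} {y} {S} x≡y closed r Sr = subst (T ∘ S) x+r≡y+r (closed r Sr)
    where
    x+r≡y+r : (x + r) % q ≡ (y + r) % q
    x+r≡y+r = begin
      (x + r) % q               ≡⟨ %-distribˡ-+ x r q ⟩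
      (x % q + r % q) % q       ≡⟨ cong (λ z → (z + r % q) % q) x≡y ⟩
      (y % q + r % q) % q       ≡⟨ %-distribˡ-+ y r q ⟨
      (y + r) % q               ∎
      where open ≡-Reasoning

  -- Closure under a unit x gives closure under 1 (via x⁻¹ x ≡ 1), hence reaches every residue from t.
  closed⇒full : ∀ {x S t} → Coprime x q → Closed x S → t < q → T (S t) → ∀ r → r < q → T (S r)
  closed⇒full {x} {S} {t} unit closed t<q St r r<q =
    subst (T ∘ S) reach (step t (subst (T ∘ S) (sym (m<n⇒m%n≡m t<q)) St))
    where
    open ≡-Reasoning
    y = proj₁ (coprime⇒inverse unit)
    one : Closed 1 S
    one = closed-% {y * x} {1} {S} (proj₂ (coprime⇒inverse unit)) (closed-* {x} {S} closed y)
    j = r + (q ∸ t)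
    step : Closed j S
    step = subst (λ m → Closed m S) (*-identityʳ j) (closed-* {1} {S} one j)
    reach : (j + t) % q ≡ r
    reach = begin
      (r + (q ∸ t) + t) % q    ≡⟨ cong (_% q) (+-assoc r (q ∸ t) t) ⟩
      (r + (q ∸ t + t)) % q    ≡⟨ cong (λ z → (r + z) % q) (m∸n+n≡m (<⇒≤ t<q)) ⟩
      (r + q) % q              ≡⟨ [m+n]%n≡m%n r q ⟩
      r % q                    ≡⟨ m<n⇒m%n≡m r<q ⟩
      r                        ∎

  shift-stable⇒full : ∀ x S → Coprime x q → 0 < card q S → card q (S ∪ shift x S) ≤ card q S → card q S ≡ q
  shift-stable⇒full x S unit nonempty stable = card-full q S (closed⇒full unit closed t<q St)
    where
    S⊆shift : ∀ r → r < q → T (S r) → T (shift x S r)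
    S⊆shift = card-∪≤⇒⊆ q S (shift x S) (subst (card q (S ∪ shift x S) ≤_) (sym (card-shift x S)) stable)
    closed : Closed x S
    closed r Sr = subst (T ∘ S) ([m+n%d]%d≡[m+n]%d x r q) (S⊆shift (r % q) (m%n<n r q) Sr)
    witness = card>0⇒witness q S nonempty
    t = proj₁ witness
    t<q = proj₁ (proj₂ witness)
    St = proj₂ (proj₂ witness)

  hits : (ℕ → Bool) → Vec (Fin q) n → ℕ
  hits {n} S a = count (λ ε → S (subsetSum ε a % q)) (allChoices n)

  hits-∷ : ∀ S x (as : Vec (Fin q) n) → hits S (x ∷ as) ≡ hits S as + hits (shift (toℕ x) S) as
  hits-∷ {n} S x as = trans (count-allChoices (λ ε → S (subsetSum ε (x ∷ as) % q))) (cong (hits S as +_) (count-cong reduce (allChoices n)))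
    where
    reduce : ∀ ε → S ((toℕ x + subsetSum ε as) % q) ≡ shift (toℕ x) S (subsetSum ε as % q)
    reduce ε = cong S (sym ([m+n%d]%d≡[m+n]%d (toℕ x) (subsetSum ε as) q))

  hits-sameCover : ∀ {S S′ U V} (a : Vec (Fin q) n) → SameCover q S S′ U V →
    hits S a + hits S′ a ≡ hits U a + hits V a
  hits-sameCover {n} a cover = count-exchange (λ ε → cover _ (m%n<n (subsetSum ε a) q)) (allChoices n)

  hits≤2^n : ∀ S (a : Vec (Fin q) n) → hits S a ≤ 2 ^ n
  hits≤2^n {n} S a = subst (hits S a ≤_) (length-allChoices n) (count≤length _ (allChoices n))

  hits-empty : ∀ S (a : Vec (Fin q) n) → card q S ≡ 0 → hits S a ≡ 0
  hits-empty {n} S a empty = count-none (λ ε → card≡0⇒none q S empty _ (m%n<n (subsetSum ε a) q)) (allChoices n)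

  -- Rebalancing S and its translate does not change the number of hits over the tail.
  compress : ∀ S x (as : Vec (Fin q) n) j → card q S ≡ suc j → suc (suc j) ≤ card q (S ∪ shift (toℕ x) S) →
    Σ (ℕ → Bool) λ U → Σ (ℕ → Bool) λ V →
      card q U ≡ suc (suc j) × card q V ≡ j × hits S (x ∷ as) ≡ hits U as + hits V as
  compress S x as j |S| grows = U , V , |U| , |V| , hits-split
    where
    S′ = shift (toℕ x) S
    |S′| : card q S′ ≡ suc j
    |S′| = trans (card-shift (toℕ x) S) |S|
    |S∩S′|≤ : card q (S ∩ S′) ≤ suc (suc j)
    |S∩S′|≤ = m≤n⇒m≤1+n (subst (card q (S ∩ S′) ≤_) |S| (card-mono q (λ r _ → ∧-elimˡ {S r} {S′ r})))
    rebalanced = rebalance q S S′ (suc (suc j)) |S∩S′|≤ grows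
    U = proj₁ rebalanced
    V = proj₁ (proj₂ rebalanced)
    |U| = proj₁ (proj₂ (proj₂ rebalanced))
    cover = proj₂ (proj₂ (proj₂ rebalanced))
    |V| : card q V ≡ j
    |V| = +-cancelˡ-≡ (suc (suc j)) _ _ (begin
      suc (suc j) + card q V        ≡⟨ cong (_+ card q V) |U| ⟨
      card q U + card q V           ≡⟨ card-sameCover q {S} {S′} {U} {V} cover ⟨
      card q S + card q S′          ≡⟨ cong₂ _+_ |S| |S′| ⟩
      suc j + suc j                 ≡⟨ +-suc (suc j) j ⟩
      suc (suc j) + j               ∎)
      where open ≡-Reasoning
    hits-split : hits S (x ∷ as) ≡ hits U as + hits V as
    hits-split = trans (hits-∷ S x as) (hits-sameCover {S = S} {S′} {U} {V} as cover)

  hits≤topBinomials : ∀ n (a : Vec (Fin q) n) → All (λ x → Coprime (toℕ x) q) a →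
    ∀ j S → card q S ≡ j → n + j < 2 * q → hits S a ≤ topBinomials n j
  hits≤topBinomials n a units j S |S| bound with n <? j
  ... | yes n<j = subst (hits S a ≤_) (sym (topBinomials-saturated n<j)) (hits≤2^n S a)
  hits≤topBinomials n a units zero S |S| bound | no _ = subst (_≤ _) (sym (hits-empty S a |S|)) z≤n
  hits≤topBinomials zero a units (suc j) S |S| bound | no n≮j = ⊥-elim (n≮j z<s)
  hits≤topBinomials (suc m) (x ∷ as) (unit ∷ units) (suc j) S |S| bound | no n≮j
    with suc (suc j) ≤? card q (S ∪ shift (toℕ x) S)
  ... | yes grows =
    let U , V , |U| , |V| , split = compress S x as j |S| grows in
    begin
      hits S (x ∷ as)                                  ≡⟨ split ⟩
      hits U as + hits V as                            ≤⟨ +-mono-≤ (hits≤topBinomials m as units _ U |U| boundU)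
                                                                   (hits≤topBinomials m as units j V |V| boundV) ⟩
      topBinomials m (suc (suc j)) + topBinomials m j  ∎
    where
    open ≤-Reasoning
    boundU : m + suc (suc j) < 2 * q
    boundU = subst (_< 2 * q) (sym (+-suc m (suc j))) bound
    boundV : m + j < 2 * q
    boundV = ≤-<-trans (+-monoʳ-≤ m (m≤n⇒m≤1+n (n≤1+n j))) boundU
  -- Otherwise S is invariant under translation by the unit x, so S is all of ℤ_q, too large for the bound.
  ... | no stable = ⊥-elim (n≮j (subst (suc m <_) (trans (sym full) |S|) (m+n<2n⇒m<n (suc m) q boundq)))
    where
    full : card q S ≡ q
    full = shift-stable⇒full (toℕ x) S unit (subst (0 <_) (sym |S|) z<s)
             (subst (card q (S ∪ shift (toℕ x) S) ≤_) (sym |S|) (s≤s⁻¹ (≰⇒> stable)))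
    boundq : suc m + q < 2 * q
    boundq = subst (λ z → suc m + z < 2 * q) (trans (sym |S|) full) bound

  zeroSumCount≤ : ∀ n → ⌈ n /2⌉ < q → (a : Vec (Fin q) n) → All (λ x → Coprime (toℕ x) q) a →
    zeroSumCount q a ≤ n C ⌊ n /2⌋
  zeroSumCount≤ n h a units = begin
    zeroSumCount q a    ≡⟨ length-filter≡count (zeroSum? q a) (allChoices n) ⟩
    hits isZero a       ≤⟨ hits≤topBinomials n a units 1 isZero (cong suc (card-none k)) (⌈n/2⌉<m⇒n+1<2m n q h) ⟩
    topBinomials n 1    ≡⟨ topBinomials-1 n ⟩
    n C ⌊ n /2⌋         ∎
    where
    open ≤-Reasoning
    isZero : ℕ → Bool
    isZero r = isYes (r ≟ 0)

-- The extremal sequence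

agreements : Vec Bool n → Vec Bool n → ℕ
agreements []          []          = 0
agreements (true ∷ ε)  (true ∷ s)  = suc (agreements ε s)
agreements (false ∷ ε) (false ∷ s) = suc (agreements ε s)
agreements (true ∷ ε)  (false ∷ s) = agreements ε s
agreements (false ∷ ε) (true ∷ s)  = agreements ε s

count-agreements : ∀ (s : Vec Bool n) t → count (λ ε → agreements ε s ≡ᵇ t) (allChoices n) ≡ n C t
count-agreements []      zero    = refl
count-agreements []      (suc t) = refl
count-agreements {suc n} (b ∷ s) t = trans (count-allChoices (λ ε → agreements ε (b ∷ s) ≡ᵇ t)) (split b)
  where
  headAgrees headDisagrees : ℕ
  headAgrees    = count (λ ε → suc (agreements ε s) ≡ᵇ t) (allChoices n)
  headDisagrees = count (λ ε → agreements ε s ≡ᵇ t) (allChoices n)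
  pascal : ∀ t → count (λ ε → suc (agreements ε s) ≡ᵇ t) (allChoices n)
               + count (λ ε → agreements ε s ≡ᵇ t) (allChoices n) ≡ suc n C t
  pascal zero    = cong₂ _+_ (count-none (λ _ ()) (allChoices n)) (count-agreements s 0)
  pascal (suc t) = trans (cong₂ _+_ (count-agreements s t) (count-agreements s (suc t))) (nCk+nC[k+1]≡[n+1]C[k+1] n t)
  split : ∀ b → count (λ ε → agreements (false ∷ ε) (b ∷ s) ≡ᵇ t) (allChoices n)
              + count (λ ε → agreements (true ∷ ε) (b ∷ s) ≡ᵇ t) (allChoices n) ≡ suc n C t
  split false = pascal t
  split true  = trans (+-comm headDisagrees headAgrees) (pascal t)

negatives : Vec Bool n → ℕ
negatives []          = 0
negatives (true ∷ s)  = negatives s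
negatives (false ∷ s) = suc (negatives s)

negativesChosen : Vec Bool n → Vec Bool n → ℕ
negativesChosen []          []          = 0
negativesChosen (true ∷ ε)  (false ∷ s) = suc (negativesChosen ε s)
negativesChosen (_ ∷ ε)     (_ ∷ s)     = negativesChosen ε s

alternating : ∀ n → Vec Bool n
alternating zero          = []
alternating (suc zero)    = true ∷ []
alternating (suc (suc n)) = true ∷ false ∷ alternating n

negatives-alternating : ∀ n → negatives (alternating n) ≡ ⌊ n /2⌋
negatives-alternating zero          = refl
negatives-alternating (suc zero)    = refl
negatives-alternating (suc (suc n)) = cong suc (negatives-alternating n)

module Signs (k : ℕ) where

  q : ℕ
  q = suc (suc k)

  sign : Bool → Fin q
  sign true  = Fin.suc Fin.zero
  sign false = Fin.fromℕ (suc k)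

  signs : Vec Bool n → Vec (Fin q) n
  signs = Vec.map sign

  sign-coprime : ∀ b → Coprime (toℕ (sign b)) q
  sign-coprime true  = 1-coprimeTo q
  sign-coprime false = subst (λ m → Coprime m q) (sym (toℕ-fromℕ (suc k)))
    (Coprime-sym (subst (λ m → Coprime m (suc k)) (+-comm (suc k) 1) (coprime-+ (1-coprimeTo (suc k)))))

  signs-coprime : ∀ (s : Vec Bool n) → All (λ x → Coprime (toℕ x) q) (signs s)
  signs-coprime s = map⁺ (universal sign-coprime s)

  -- Each chosen −1 contributes q − 1, whence the multiple of q.
  subsetSum-signs : ∀ (ε s : Vec Bool n) →
    subsetSum ε (signs s) + negatives s ≡ agreements ε s + q * negativesChosen ε s
  subsetSum-signs []          []          = sym (*-zeroʳ q)
  subsetSum-signs (true ∷ ε)  (true ∷ s)  = cong suc (subsetSum-signs ε s)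
  subsetSum-signs (false ∷ ε) (true ∷ s)  = subsetSum-signs ε s
  subsetSum-signs (false ∷ ε) (false ∷ s) = trans (+-suc _ (negatives s)) (cong suc (subsetSum-signs ε s))
  subsetSum-signs (true ∷ ε)  (false ∷ s) = begin
    toℕ (sign false) + σ + suc ν  ≡⟨ cong (λ m → m + σ + suc ν) (toℕ-fromℕ (suc k)) ⟩
    suc k + σ + suc ν             ≡⟨ regroup k σ ν ⟩
    q + (σ + ν)                   ≡⟨ cong (q +_) (subsetSum-signs ε s) ⟩
    q + (α + q * μ)               ≡⟨ regroup′ q α μ ⟩
    α + q * suc μ                 ∎
    where
    open ≡-Reasoning
    σ = subsetSum ε (signs s)
    ν = negatives s
    α = agreements ε s
    μ = negativesChosen ε s
    regroup : ∀ k x y → suc k + x + suc y ≡ suc (suc k) + (x + y)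
    regroup = solve-∀
    regroup′ : ∀ q a m → q + (a + q * m) ≡ a + q * suc m
    regroup′ = solve-∀

  -- agreements ε s counts the chosen +1s and the unchosen −1s, so it equals negatives s
  -- exactly when as many +1s as −1s are chosen.
  zeroSum-signs : ∀ (ε s : Vec Bool n) → agreements ε s ≡ negatives s → ZeroSum q (signs s) ε
  zeroSum-signs ε s balanced = begin
    subsetSum ε (signs s) % q             ≡⟨ cong (_% q) Σ≡qM ⟩
    (q * negativesChosen ε s) % q         ≡⟨ cong (_% q) (*-comm q (negativesChosen ε s)) ⟩
    (negativesChosen ε s * q) % q         ≡⟨ m*n%n≡0 (negativesChosen ε s) q ⟩
    0                                     ∎
    where
    open ≡-Reasoning
    Σ≡qM : subsetSum ε (signs s) ≡ q * negativesChosen ε s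
    Σ≡qM = +-cancelʳ-≡ (negatives s) _ _
      (trans (subsetSum-signs ε s) (trans (cong (_+ q * negativesChosen ε s) balanced) (+-comm (negatives s) _)))

  zeroSumCount-alternating : ∀ n → n C ⌊ n /2⌋ ≤ zeroSumCount q (signs (alternating n))
  zeroSumCount-alternating n = begin
    n C ⌊ n /2⌋                                               ≡⟨ count-agreements s ⌊ n /2⌋ ⟨
    count (λ ε → agreements ε s ≡ᵇ ⌊ n /2⌋) (allChoices n)    ≤⟨ count-mono balanced⇒zeroSum (allChoices n) ⟩
    count (isYes ∘ zeroSum? q (signs s)) (allChoices n)       ≡⟨ length-filter≡count (zeroSum? q (signs s)) (allChoices n) ⟨
    zeroSumCount q (signs s)                                  ∎
    where
    open ≤-Reasoning
    s = alternating n
    balanced⇒zeroSum : ∀ ε → T (agreements ε s ≡ᵇ ⌊ n /2⌋) → T (isYes (zeroSum? q (signs s) ε))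
    balanced⇒zeroSum ε balanced =
      fromWitness (zeroSum-signs ε s (trans (≡ᵇ⇒≡ _ _ balanced) (sym (negatives-alternating n))))

extremal : ∀ k n → ⌈ n /2⌉ < suc k →
  Σ (Vec (Fin (suc k)) n) (λ a → All (λ x → Coprime (toℕ x) (suc k)) a × zeroSumCount (suc k) a ≡ n C ⌊ n /2⌋)
extremal zero    zero    _        = [] , [] , refl
extremal zero    (suc n) (s≤s ())
extremal (suc k) n       h        =
  signs (alternating n) , signs-coprime (alternating n) ,
  ≤-antisym (Residues.zeroSumCount≤ (suc k) n h _ (signs-coprime (alternating n))) (zeroSumCount-alternating n)
  where open Signs k

corollary1 : (k n : ℕ) → ⌈ n /2⌉ < suc k →
    ((a : Vec (Fin (suc k)) n) → All (λ x → Coprime (toℕ x) (suc k)) a →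
      zeroSumCount (suc k) a ≤ n C ⌊ n /2⌋)
    × Σ (Vec (Fin (suc k)) n) (λ a → All (λ x → Coprime (toℕ x) (suc k)) a × zeroSumCount (suc k) a ≡ n C ⌊ n /2⌋)
corollary1 k n h = Residues.zeroSumCount≤ k n h , extremal k n h
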